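{- In the black-box model with a distance oracle, the worst-case complexity of decoding non-linear binary codes is $\Omega(S)$: for every $n\ge4$ there exist a code $X_n\subseteq(\mathbb{F}_2)^n$ of size $S=|X_n|$ and a query $q_n\in(\mathbb{F}_2)^n$ such that any algorithm that outputs the codeword(s) of $X_n$ closest to $q_n$ must, in the worst case, perform $\Omega(S)$ distance computations.
   Context: In the black-box model with distance oracle, an algorithm receives a code $X\subseteq(\mathbb{F}_2)^n$ (a set of $S$ points, not necessarily linear) and a query point $q$, and can only obtain information by calling an oracle returning the Hamming distance $\mathrm{d}(x,y)$ between two given points; it may use previously obtained distances (e.g. through the triangle inequality $\mathrm{d}(x,z)\ge\mathrm{d}(x,y)-\mathrm{d}(y,z)$) to avoid further calls. Complexity is the number of oracle calls. Decoding means returning the point(s) of $X$ at minimum Hamming distance from $q$. -}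

module Defs where

open import Data.Nat using (ℕ; zero; suc; _+_; _*_; _≤_)
open import Data.Bool using (Bool; true; false; _xor_)
open import Data.Vec using (Vec; []; _∷_)
open import Data.Fin using (Fin)
open import Data.Fin.Permutation using (Permutation′; _⟨$⟩ʳ_)
open import Data.Maybe using (Maybe; just; nothing)
open import Data.Product using (_×_; _,_; Σ; ∃; ∃-syntax)
open import Function using (_∘_)
open import Function.Definitions using (Injective)
open import Relation.Binary.PropositionalEquality using (_≡_)

Point : ℕ → Set
Point n = Vec Bool n

hamming : ∀ {n} → Point n → Point n → ℕ
hamming [] [] = 0
hamming (a ∷ u) (b ∷ v) with a xor b
... | true  = suc (hamming u v)
... | false = hamming u v

record Instance (n : ℕ) : Set where
  field
    size   : ℕ
    code   : Fin size → Point n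
    codeInj : Injective _≡_ _≡_ code
    query  : Point n
open Instance public

-- Labels (handles) the black-box algorithm sees: the S codewords
-- (just i) and the query point (nothing).  It never sees coordinates.
Label : ℕ → Set
Label S = Maybe (Fin S)

-- A deterministic black-box algorithm = a decision tree: either stop and
-- output (the label of) a codeword, or ask the oracle for the distance
-- between two labelled points and continue depending on the answer.
-- All free reasoning (triangle inequality, reuse of known distances, …)
-- is encoded in the shape of the tree.
data Alg (S : ℕ) : Set where
  output : Fin S → Alg S
  ask    : Label S → Label S → (ℕ → Alg S) → Alg S

run : ∀ {S} → Alg S → (Label S → Label S → ℕ) → Fin S × ℕ
run (output i) d = i , 0
run (ask a b k) d with run (k (d a b)) d
... | i , c = i , suc c

-- The presentation of the code to the algorithm: codewords are given in
-- an arbitrary order, i.e. label i denotes codeword  code (σ i).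
point : ∀ {n} (I : Instance n) → Permutation′ (size I) → Label (size I) → Point n
point I σ nothing  = query I
point I σ (just i) = code I (σ ⟨$⟩ʳ i)

oracle : ∀ {n} (I : Instance n) → Permutation′ (size I) → Label (size I) → Label (size I) → ℕ
oracle I σ a b = hamming (point I σ a) (point I σ b)

IsClosest : ∀ {n} (I : Instance n) → Permutation′ (size I) → Fin (size I) → Set
IsClosest I σ i = ∀ j → hamming (query I) (point I σ (just i)) ≤ hamming (query I) (point I σ (just j))

Decodes : ∀ {n} (I : Instance n) → Alg (size I) → Set
Decodes I A = ∀ σ → IsClosest I σ (Data.Product.proj₁ (run A (oracle I σ)))

cost : ∀ {n} (I : Instance n) → Alg (size I) → Permutation′ (size I) → ℕ
cost I A σ = Data.Product.proj₂ (run A (oracle I σ))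

module Submission where

-- An adversary argument.  The hard instance in dimension n = m + 1 is the
-- code of the n unit vectors e₀, …, e_{n-1}, queried at q = e₀: q is itself
-- a codeword, every other codeword is at distance 2 from it.
--
-- The adversary answers every query with the equidistant oracle, in which
-- any two distinct labelled points are at distance 2.  This agrees with the
-- true oracle of a presentation σ on all pairs of labels avoiding the label
-- p with σ p = 0 (the hidden copy of q).  Hence, after k questions under the
-- equidistant oracle, at most 2k labels have been mentioned; if together
-- with the eventual output they do not exhaust all S labels, hide q behind a
-- missing label p.  The true run then either takes at least k questions, or
-- coincides with the adversary run and outputs a label different from p,
-- i.e. a codeword at distance 2 > 0 from q, contradicting correctness.
-- Taking k = 1 + ⌊(n-4)/2⌋ gives S = n ≤ 5k.

open import Defs
open import Data.Nat using (ℕ; _≤_; _*_)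
open import Data.Product using (Σ; ∃; ∃-syntax; _×_)

open import Data.Nat using (zero; suc; _+_; _<_; z≤n; s≤s; ⌊_/2⌋)
open import Data.Nat.Properties
  using (≤-refl; ≤-reflexive; ≤-trans; m≤m+n; m≤n+m; +-suc; +-mono-≤; +-monoʳ-≤; *-monoʳ-≤;
         ⌊n/2⌋≤⌈n/2⌉; ⌊n/2⌋+⌈n/2⌉≡n; module ≤-Reasoning)
open import Data.Nat.Tactic.RingSolver using (solve-∀)
open import Data.Bool using (true; false)
open import Data.Vec using ([]; _∷_; replicate)
open import Data.Fin using (Fin) renaming (zero to fzero; suc to fsuc; _<_ to _<ᶠ_)
import Data.Fin.Properties as Fin
open import Data.Fin.Permutation using (Permutation′; _⟨$⟩ʳ_; transpose)
open import Data.Maybe using (nothing; just)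
import Data.Maybe.Properties as Maybe
open import Data.Product using (_,_; proj₁; proj₂)
open import Data.Sum using (_⊎_; inj₁; inj₂)
open import Data.Empty using (⊥; ⊥-elim)
open import Data.List using (List; []; _∷_; _++_; length; lookup)
open import Data.List.Properties using (length-++)
open import Data.List.Membership.Propositional using (_∈_; _∉_)
open import Data.List.Membership.Propositional.Properties using (∈-++⁺ˡ; ∈-++⁺ʳ)
import Data.List.Membership.DecPropositional as DecMembership
open import Data.List.Relation.Unary.Any using (here; there; index)
open import Data.List.Relation.Unary.Any.Properties using (lookup-index)
open import Function.Bundles using (Injection)
open import Function.Definitions using (Injective)
open import Function.Properties.Inverse using (↔⇒↣)
open import Relation.Nullary using (Dec; yes; no)
open import Relation.Binary.PropositionalEquality
  using (_≡_; _≢_; refl; sym; trans; cong; module ≡-Reasoning)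

unit : ∀ {n} → Fin n → Point n
unit fzero    = true ∷ replicate _ false
unit (fsuc i) = false ∷ unit i

hamming-self : ∀ {n} (v : Point n) → hamming v v ≡ 0
hamming-self []          = refl
hamming-self (true ∷ v)  = hamming-self v
hamming-self (false ∷ v) = hamming-self v

hamming-sym : ∀ {n} (u v : Point n) → hamming u v ≡ hamming v u
hamming-sym []          []          = refl
hamming-sym (true ∷ u)  (true ∷ v)  = hamming-sym u v
hamming-sym (true ∷ u)  (false ∷ v) = cong suc (hamming-sym u v)
hamming-sym (false ∷ u) (true ∷ v)  = cong suc (hamming-sym u v)
hamming-sym (false ∷ u) (false ∷ v) = hamming-sym u v

hamming-zero-unit : ∀ {n} (i : Fin n) → hamming (replicate n false) (unit i) ≡ 1
hamming-zero-unit {suc n} fzero = cong suc (hamming-self (replicate n false))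
hamming-zero-unit (fsuc i)      = hamming-zero-unit i

hamming-unit-distinct : ∀ {n} {i j : Fin n} → i ≢ j → hamming (unit i) (unit j) ≡ 2
hamming-unit-distinct {i = fzero}  {fzero}  i≢j = ⊥-elim (i≢j refl)
hamming-unit-distinct {i = fzero}  {fsuc j} i≢j = cong suc (hamming-zero-unit j)
hamming-unit-distinct {i = fsuc i} {fzero}  i≢j =
  cong suc (trans (hamming-sym (unit i) _) (hamming-zero-unit i))
hamming-unit-distinct {i = fsuc i} {fsuc j} i≢j =
  hamming-unit-distinct (λ i≡j → i≢j (cong fsuc i≡j))

unit-injective : ∀ {n} → Injective _≡_ _≡_ (unit {n})
unit-injective {x = i} {j} eᵢ≡eⱼ with i Fin.≟ j
... | yes i≡j = i≡j
... | no  i≢j with trans (sym (hamming-unit-distinct i≢j))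
                         (trans (cong (hamming (unit i)) (sym eᵢ≡eⱼ)) (hamming-self (unit i)))
...   | ()

unitCode : (m : ℕ) → Instance (suc m)
unitCode m = record { size = suc m ; code = unit ; codeInj = unit-injective ; query = unit fzero }

hardInstance : (n : ℕ) → 4 ≤ n → Instance n
hardInstance (suc m) (s≤s _) = unitCode m

codewordLabels : ∀ {S} → Label S → List (Fin S)
codewordLabels nothing  = []
codewordLabels (just i) = i ∷ []

codewordLabels-length : ∀ {S} (a : Label S) → length (codewordLabels a) ≤ 1
codewordLabels-length nothing  = z≤n
codewordLabels-length (just _) = s≤s z≤n

askedWithin : ∀ {S} → ℕ → Alg S → (Label S → Label S → ℕ) → List (Fin S)
askedWithin zero    A           d = []
askedWithin (suc k) (output i)  d = []
askedWithin (suc k) (ask a b f) d =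
  codewordLabels a ++ codewordLabels b ++ askedWithin k (f (d a b)) d

askedWithin-length : ∀ {S} k (A : Alg S) d → length (askedWithin k A d) ≤ k + k
askedWithin-length zero    A           d = z≤n
askedWithin-length (suc k) (output i)  d = z≤n
askedWithin-length {S} (suc k) (ask a b f) d = begin
  length (as ++ bs ++ rest)                   ≡⟨ length-++ as ⟩
  length as + length (bs ++ rest)             ≡⟨ cong (length as +_) (length-++ bs) ⟩
  length as + (length bs + length rest)       ≤⟨ +-mono-≤ (codewordLabels-length a)
                                                   (+-mono-≤ (codewordLabels-length b)
                                                     (askedWithin-length k (f (d a b)) d)) ⟩
  suc (suc (k + k))                           ≡⟨ cong suc (sym (+-suc k k)) ⟩
  suc k + suc k                               ∎
  where
  open ≤-Reasoning
  as bs rest : List (Fin S)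
  as   = codewordLabels a
  bs   = codewordLabels b
  rest = askedWithin k (f (d a b)) d

Avoids : ∀ {S} → Fin S → Label S → Set
Avoids p a = a ≢ just p

∉-codewordLabels : ∀ {S} {p : Fin S} (a : Label S) → p ∉ codewordLabels a → Avoids p a
∉-codewordLabels (just _) p∉ refl = p∉ (here refl)

simulation : ∀ {S} (p : Fin S) (d d′ : Label S → Label S → ℕ) →
             (∀ a b → Avoids p a → Avoids p b → d′ a b ≡ d a b) →
             ∀ k (A : Alg S) → p ∉ askedWithin k A d →
             k ≤ proj₂ (run A d′) ⊎ run A d′ ≡ run A d
simulation p d d′ agree zero    A           p∉ = inj₁ z≤n
simulation p d d′ agree (suc k) (output i)  p∉ = inj₂ refl
simulation p d d′ agree (suc k) (ask a b f) p∉
  rewrite agree a b (∉-codewordLabels a (λ p∈ → p∉ (∈-++⁺ˡ p∈)))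
                    (∉-codewordLabels b (λ p∈ → p∉ (∈-++⁺ʳ (codewordLabels a) (∈-++⁺ˡ p∈))))
  with simulation p d d′ agree k (f (d a b))
         (λ p∈ → p∉ (∈-++⁺ʳ (codewordLabels a) (∈-++⁺ʳ (codewordLabels b) p∈)))
... | inj₁ k≤cost  = inj₁ (s≤s k≤cost)
... | inj₂ sameRun rewrite sameRun = inj₂ refl

_∈?_ : ∀ {S} (p : Fin S) (L : List (Fin S)) → Dec (p ∈ L)
_∈?_ {S} = DecMembership._∈?_ (Fin._≟_ {S})

missingLabel : ∀ {S} (L : List (Fin S)) → length L < S → ∃[ p ] p ∉ L
missingLabel {S} L short with Fin.all? {n = S} (_∈? L)
... | no ¬all = Fin.¬∀⟶∃¬ S (_∈ L) (_∈? L) ¬all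
... | yes all = ⊥-elim (collision (Fin.pigeonhole short position))
  where
  position : Fin S → Fin (length L)
  position i = index (all i)

  collision : ∃[ i ] ∃[ j ] (i <ᶠ j × position i ≡ position j) → ⊥
  collision (i , j , i<j , samePosition) = Fin.<⇒≢ i<j (begin
    i                     ≡⟨ lookup-index (all i) ⟩
    lookup L (position i) ≡⟨ cong (lookup L) samePosition ⟩
    lookup L (position j) ≡⟨ sym (lookup-index (all j)) ⟩
    j                     ∎)
    where open ≡-Reasoning

_≟ₗ_ : ∀ {S} (a b : Label S) → Dec (a ≡ b)
_≟ₗ_ = Maybe.≡-dec Fin._≟_

equidistant : ∀ {S} → Label S → Label S → ℕ
equidistant a b with a ≟ₗ b
... | yes _ = 0
... | no  _ = 2

unitIndex : ∀ {m} → Permutation′ (suc m) → Label (suc m) → Fin (suc m)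
unitIndex σ nothing  = fzero
unitIndex σ (just i) = σ ⟨$⟩ʳ i

point-unitCode : ∀ m (σ : Permutation′ (suc m)) (a : Label (suc m)) →
                 point (unitCode m) σ a ≡ unit (unitIndex σ a)
point-unitCode m σ nothing  = refl
point-unitCode m σ (just i) = refl

-- The presentation hiding the query behind p is the transposition of p and 0.
transpose-sends : ∀ {S} (p q : Fin S) → transpose p q ⟨$⟩ʳ p ≡ q
transpose-sends p q with p Fin.≟ p
... | yes _   = refl
... | no  p≢p = ⊥-elim (p≢p refl)

permutation-injective : ∀ {S} (σ : Permutation′ S) → Injective _≡_ _≡_ (σ ⟨$⟩ʳ_)
permutation-injective σ = Injection.injective (↔⇒↣ σ)

unitIndex-injective : ∀ {m} (σ : Permutation′ (suc m)) (p : Fin (suc m)) → σ ⟨$⟩ʳ p ≡ fzero →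
                      ∀ {a b} → Avoids p a → Avoids p b →
                      unitIndex σ a ≡ unitIndex σ b → a ≡ b
unitIndex-injective σ p hidden {nothing} {nothing} _ _ _ = refl
unitIndex-injective σ p hidden {nothing} {just j} _ avoidsB 0≡σj =
  ⊥-elim (avoidsB (cong just (permutation-injective σ (trans (sym 0≡σj) (sym hidden)))))
unitIndex-injective σ p hidden {just i} {nothing} avoidsA _ σi≡0 =
  ⊥-elim (avoidsA (cong just (permutation-injective σ (trans σi≡0 (sym hidden)))))
unitIndex-injective σ p hidden {just i} {just j} _ _ σi≡σj =
  cong just (permutation-injective σ σi≡σj)

oracle-agrees : ∀ m (σ : Permutation′ (suc m)) (p : Fin (suc m)) → σ ⟨$⟩ʳ p ≡ fzero →
                ∀ a b → Avoids p a → Avoids p b →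
                oracle (unitCode m) σ a b ≡ equidistant a b
oracle-agrees m σ p hidden a b avoidsA avoidsB
  rewrite point-unitCode m σ a | point-unitCode m σ b with a ≟ₗ b
... | yes refl = hamming-self (unit (unitIndex σ a))
... | no  a≢b  = hamming-unit-distinct
                   (λ same → a≢b (unitIndex-injective σ p hidden avoidsA avoidsB same))

-- A correct decoder cannot run against the presentation hiding q behind p
-- exactly as against the adversary, unless the adversary run outputs p:
-- otherwise it would output a codeword at distance 2 from q, while the
-- codeword behind p is q itself.
hiddenQuery-detected : ∀ m (A : Alg (suc m)) → Decodes (unitCode m) A →
                       ∀ p → p ≢ proj₁ (run A equidistant) →
                       run A (oracle (unitCode m) (transpose p fzero)) ≢ run A equidistant
hiddenQuery-detected m A decodes p p≢o sameRun = impossible (begin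
  2                                         ≡⟨ sym (oracle-agrees m σ p hidden nothing (just o) (λ ())
                                                 (λ o≡p → p≢o (sym (Maybe.just-injective o≡p)))) ⟩
  hamming q (point (unitCode m) σ (just o)) ≡⟨ cong (λ r → hamming q (point (unitCode m) σ (just (proj₁ r))))
                                                 (sym sameRun) ⟩
  hamming q (point (unitCode m) σ (just (proj₁ (run A (oracle (unitCode m) σ)))))
                                            ≤⟨ decodes σ p ⟩
  hamming q (unit (σ ⟨$⟩ʳ p))               ≡⟨ cong (λ i → hamming q (unit i)) hidden ⟩
  hamming q q                               ≡⟨ hamming-self q ⟩
  0                                         ∎)
  where
  open ≤-Reasoning
  σ : Permutation′ (suc m)
  σ = transpose p fzero

  hidden : σ ⟨$⟩ʳ p ≡ fzero
  hidden = transpose-sends p fzero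

  q : Point (suc m)
  q = query (unitCode m)

  o : Fin (suc m)
  o = proj₁ (run A equidistant)

  impossible : 2 ≤ 0 → ⊥
  impossible ()

-- Any correct decoder of the unit-vector code of size S = m + 1 needs at
-- least k questions on some presentation, as soon as 2k + 1 < S: hide q
-- behind a label neither output nor mentioned in the first k adversary
-- questions.
unitCode-lowerBound : ∀ m (A : Alg (suc m)) → Decodes (unitCode m) A →
                      ∀ k → suc (k + k) < suc m → ∃[ σ ] k ≤ cost (unitCode m) A σ
unitCode-lowerBound m A decodes k short = hideQueryAt (missingLabel mentioned fewLabels)
  where
  mentioned : List (Fin (suc m))
  mentioned = proj₁ (run A equidistant) ∷ askedWithin k A equidistant

  fewLabels : length mentioned < suc m
  fewLabels = ≤-trans (s≤s (s≤s (askedWithin-length k A equidistant))) short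

  hideQueryAt : ∃[ p ] p ∉ mentioned → ∃[ σ ] k ≤ cost (unitCode m) A σ
  hideQueryAt (p , p∉) with simulation p equidistant (oracle (unitCode m) (transpose p fzero))
                              (oracle-agrees m _ p (transpose-sends p fzero)) k A (λ p∈ → p∉ (there p∈))
  ... | inj₁ k≤cost  = transpose p fzero , k≤cost
  ... | inj₂ sameRun = ⊥-elim (hiddenQuery-detected m A decodes p (λ p≡o → p∉ (here p≡o)) sameRun)

-- The number of questions forced on a code of size S = t + 4 is
-- k = 1 + ⌊t/2⌋: then 2k + 1 < S and S ≤ 5k.
questions : ℕ → ℕ
questions t = suc ⌊ t /2⌋

double-⌊n/2⌋≤n : ∀ t → ⌊ t /2⌋ + ⌊ t /2⌋ ≤ t
double-⌊n/2⌋≤n t = ≤-trans (+-monoʳ-≤ ⌊ t /2⌋ (⌊n/2⌋≤⌈n/2⌉ t)) (≤-reflexive (⌊n/2⌋+⌈n/2⌉≡n t))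

n≤1+double-⌊n/2⌋ : ∀ t → t ≤ suc (⌊ t /2⌋ + ⌊ t /2⌋)
n≤1+double-⌊n/2⌋ zero          = z≤n
n≤1+double-⌊n/2⌋ (suc zero)    = s≤s z≤n
n≤1+double-⌊n/2⌋ (suc (suc t)) rewrite +-suc ⌊ t /2⌋ ⌊ t /2⌋ = s≤s (s≤s (n≤1+double-⌊n/2⌋ t))

questions-fit : ∀ t → suc (questions t + questions t) < 4 + t
questions-fit t = begin-strict
  suc (suc h + suc h) ≡⟨ cong (λ x → suc (suc x)) (+-suc h h) ⟩
  3 + (h + h)         <⟨ s≤s (≤-refl {3 + (h + h)}) ⟩
  4 + (h + h)         ≤⟨ +-monoʳ-≤ 4 (double-⌊n/2⌋≤n t) ⟩
  4 + t               ∎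
  where
  open ≤-Reasoning
  h : ℕ
  h = ⌊ t /2⌋

questions-large : ∀ t → 4 + t ≤ 5 * questions t
questions-large t = begin
  4 + t               ≤⟨ +-monoʳ-≤ 4 (n≤1+double-⌊n/2⌋ t) ⟩
  5 + (h + h)         ≤⟨ m≤m+n (5 + (h + h)) (3 * h) ⟩
  5 + (h + h) + 3 * h ≡⟨ five-fold h ⟩
  5 * suc h           ∎
  where
  open ≤-Reasoning
  h : ℕ
  h = ⌊ t /2⌋
  five-fold : ∀ x → 5 + (x + x) + 3 * x ≡ 5 * suc x
  five-fold = solve-∀

mainTheorem14 : ∃[ c ] Σ ((n : ℕ) → 4 ≤ n → Instance n) λ X →
    ((m : ℕ) → ∃[ n ] Σ (4 ≤ n) λ h → m ≤ size (X n h))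
    × ((n : ℕ) (h : 4 ≤ n) (A : Alg (size (X n h))) → Decodes (X n h) A →
    ∃[ σ ] size (X n h) ≤ c * cost (X n h) A σ)
mainTheorem14 = 5 , hardInstance , unbounded , lowerBound
  where
  unbounded : (m : ℕ) → ∃[ n ] Σ (4 ≤ n) λ h → m ≤ size (hardInstance n h)
  unbounded m = 4 + m , s≤s (s≤s (s≤s (s≤s z≤n))) , m≤n+m m 4

  lowerBound : (n : ℕ) (h : 4 ≤ n) (A : Alg (size (hardInstance n h))) →
               Decodes (hardInstance n h) A →
               ∃[ σ ] size (hardInstance n h) ≤ 5 * cost (hardInstance n h) A σ
  lowerBound (suc (suc (suc (suc t)))) (s≤s (s≤s (s≤s (s≤s z≤n)))) A decodes
    with unitCode-lowerBound (3 + t) A decodes (questions t) (questions-fit t)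
  ... | σ , enoughQuestions = σ , ≤-trans (questions-large t) (*-monoʳ-≤ 5 enoughQuestions)
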